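{- Let $F:\mathbf{Set}\to\mathbf{Set}$ be any covariant functor and let $(G_i=(E_i,V_i,g_i))_{i\in I}$ be a family of $F$-graphs. Let $\pi^E_i:\prod_{j}E_j\to E_i$, $\pi^V_i:\prod_j V_j\to V_i$ and $p_i:\prod_j FV_j\to FV_i$ be the product projections in $\mathbf{Set}$, let $\alpha:=\langle g_i\circ\pi^E_i\rangle_{i\in I}:\prod_i E_i\to\prod_i FV_i$ (so $p_i\circ\alpha=g_i\circ\pi^E_i$) and $\beta:=\langle F(\pi^V_i)\rangle_{i\in I}:F(\prod_i V_i)\to\prod_i FV_i$ (so $p_i\circ\beta=F(\pi^V_i)$). Let $E_{prod}$ together with maps $b:E_{prod}\to\prod_i E_i$ and $g_{prod}:E_{prod}\to F(\prod_i V_i)$ be a pullback of $\alpha$ and $\beta$ in $\mathbf{Set}$ (so $\alpha\circ b=\beta\circ g_{prod}$). Then $(E_{prod},\prod_i V_i,g_{prod})$, together with the homomorphisms $\pi_i:=(\pi^E_i\circ b,\ \pi^V_i)$, is a product of the family $(G_i)_{i\in I}$ in $\mathbf{Gr}_F$.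
   Context: An $F$-graph is a triple $(E,V,g)$ with sets $E$, $V$ and a map $g:E\to FV$. A homomorphism $\phi:(E_1,V_1,g_1)\to(E_2,V_2,g_2)$ is a pair of maps $\phi_E:E_1\to E_2$, $\phi_V:V_1\to V_2$ with $g_2\circ\phi_E=F(\phi_V)\circ g_1$. With componentwise composition these form the category $\mathbf{Gr}_F$. No assumption on $F$ is made. -}

module Defs where

open import Level using (0ℓ)
open import Function using (_∘_; id)
open import Data.Product using (Σ; _×_; _,_)
open import Relation.Binary.PropositionalEquality using (_≡_)

record Functor : Set₁ where
  field
    F      : Set → Set
    fmap   : {A B : Set} → (A → B) → F A → F B
    fmap-id : {A : Set} (x : F A) → fmap id x ≡ x
    fmap-∘  : {A B C : Set} (f : A → B) (g : B → C) (x : F A) →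
              fmap (g ∘ f) x ≡ fmap g (fmap f x)

module _ (Φ : Functor) where
  open Functor Φ

  record Graph : Set₁ where
    constructor mkGraph
    field
      E : Set
      V : Set
      g : E → F V

  open Graph

  record Hom (G₁ G₂ : Graph) : Set where
    constructor mkHom
    field
      φE   : E G₁ → E G₂
      φV   : V G₁ → V G₂
      comm : (e : E G₁) → g G₂ (φE e) ≡ fmap φV (g G₁ e)

  open Hom

  _≈H_ : {G₁ G₂ : Graph} → Hom G₁ G₂ → Hom G₁ G₂ → Set
  φ ≈H ψ = ((e : _) → φE φ e ≡ φE ψ e) × ((v : _) → φV φ v ≡ φV ψ v)

  _∘H_ : {G₁ G₂ G₃ : Graph} → Hom G₂ G₃ → Hom G₁ G₂ → Hom G₁ G₃
  _∘H_ {G₁} {G₂} {G₃} ψ φ = mkHom (φE ψ ∘ φE φ) (φV ψ ∘ φV φ) c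
    where
    open Relation.Binary.PropositionalEquality using (trans; cong; sym)
    c : (e : E G₁) → g G₃ (φE ψ (φE φ e)) ≡ fmap (φV ψ ∘ φV φ) (g G₁ e)
    c e = trans (comm ψ (φE φ e))
            (trans (cong (fmap (φV ψ)) (comm φ e))
                   (sym (fmap-∘ (φV φ) (φV ψ) (g G₁ e))))

  IsProduct : {I : Set} (G : I → Graph) (P : Graph) (π : (i : I) → Hom P (G i)) → Set₁
  IsProduct {I} G P π =
    (X : Graph) (f : (i : I) → Hom X (G i)) →
    Σ (Hom X P) λ h →
      ((i : I) → (π i ∘H h) ≈H f i) ×
      ((k : Hom X P) → ((i : I) → (π i ∘H k) ≈H f i) → k ≈H h)

IsPullback : {A B C P : Set} (f : A → C) (g : B → C) (p₁ : P → A) (p₂ : P → B) → Set₁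
IsPullback {A} {B} {C} {P} f g p₁ p₂ =
  ((x : P) → f (p₁ x) ≡ g (p₂ x)) ×
  ((X : Set) (u : X → A) (v : X → B) → ((x : X) → f (u x) ≡ g (v x)) →
    Σ (X → P) λ h →
      ((x : X) → p₁ (h x) ≡ u x) × ((x : X) → p₂ (h x) ≡ v x) ×
      ((h' : X → P) → ((x : X) → p₁ (h' x) ≡ u x) → ((x : X) → p₂ (h' x) ≡ v x) →
        (x : X) → h' x ≡ h x))

-- A homomorphism X → ∏ Gᵢ is forced componentwise: its vertex map must be the tuple of the
-- vertex maps of the cone, and its edge map must factor through the pullback, whose
-- universal property both produces it and makes it unique. The compatibility of the cone
-- with the labellings gᵢ is exactly the commuting square the pullback asks for.
module Submission where

open import Defs
open import Level using (0ℓ)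
open import Axiom.Extensionality.Propositional using (Extensionality)
open import Data.Product using (Σ-syntax; _×_; _,_; proj₁; proj₂)
open import Relation.Binary.PropositionalEquality using (_≡_; cong-app; refl; trans; cong)

module _ (ext : Extensionality 0ℓ 0ℓ) (Φ : Functor) where
  open Functor Φ
  open Graph
  open Hom

  comm-≗ : {G₁ G₂ : Graph Φ} (φ : Hom Φ G₁ G₂) {h : V G₁ → V G₂} →
           ((v : V G₁) → φV φ v ≡ h v) →
           (e : E G₁) → g G₂ (φE φ e) ≡ fmap h (g G₁ e)
  comm-≗ {G₁} φ φV≗h e = trans (comm φ e) (cong (λ h → fmap h (g G₁ e)) (ext φV≗h))

  module _ {I : Set} (G : I → Graph Φ) where

    ΠE ΠV : Set
    ΠE = (i : I) → E (G i)
    ΠV = (i : I) → V (G i)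

    α : ΠE → (i : I) → F (V (G i))
    α x i = g (G i) (x i)

    β : F ΠV → (i : I) → F (V (G i))
    β y i = fmap (λ v → v i) y

    module _ {X : Graph Φ} (f : (i : I) → Hom Φ X (G i)) where

      tupleE : E X → ΠE
      tupleE e i = φE (f i) e

      tupleV : V X → ΠV
      tupleV w i = φV (f i) w

      cone-square : (e : E X) → α (tupleE e) ≡ β (fmap tupleV (g X e))
      cone-square e = ext λ i → trans (comm (f i) e) (fmap-∘ tupleV (λ v → v i) (g X e))

    module ProductFromPullback {Eprod : Set} (b : Eprod → ΠE) (gprod : Eprod → F ΠV)
                               (pb : IsPullback α β b gprod) where

      Prod : Graph Φ
      Prod = mkGraph Eprod ΠV gprod

      π : (i : I) → Hom Φ Prod (G i)
      π i = mkHom (λ e → b e i) (λ v → v i) (λ e → cong-app (proj₁ pb e) i)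

      module _ {X : Graph Φ} (f : (i : I) → Hom Φ X (G i)) where

        mediator : Σ[ h ∈ (E X → Eprod) ]
                     ((e : E X) → b (h e) ≡ tupleE f e) ×
                     ((e : E X) → gprod (h e) ≡ fmap (tupleV f) (g X e)) ×
                     ((h′ : E X → Eprod) → ((e : E X) → b (h′ e) ≡ tupleE f e) →
                       ((e : E X) → gprod (h′ e) ≡ fmap (tupleV f) (g X e)) → (e : E X) → h′ e ≡ h e)
        mediator = proj₂ pb (E X) (tupleE f) (λ e → fmap (tupleV f) (g X e)) (cone-square f)

        mediatingE : E X → Eprod
        mediatingE = proj₁ mediator

        mediating : Hom Φ X Prod
        mediating = mkHom mediatingE (tupleV f) (proj₁ (proj₂ (proj₂ mediator)))

        mediating-factors : (i : I) → _≈H_ Φ (_∘H_ Φ (π i) mediating) (f i)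
        mediating-factors i = (λ e → cong-app (proj₁ (proj₂ mediator) e) i) , (λ _ → refl)

        mediating-unique : (k : Hom Φ X Prod) → ((i : I) → _≈H_ Φ (_∘H_ Φ (π i) k) (f i)) →
                           _≈H_ Φ k mediating
        mediating-unique k k-factors = kE≗mediatingE , kV≗tupleV
          where
          kV≗tupleV : (w : V X) → φV k w ≡ tupleV f w
          kV≗tupleV w = ext λ i → proj₂ (k-factors i) w

          kE≗mediatingE : (e : E X) → φE k e ≡ mediatingE e
          kE≗mediatingE = proj₂ (proj₂ (proj₂ mediator)) (φE k)
                            (λ e → ext λ i → proj₁ (k-factors i) e) (comm-≗ k kV≗tupleV)

      isProduct : IsProduct Φ G Prod π
      isProduct X f = mediating f , mediating-factors f , mediating-unique f

theorem4p6 : Extensionality 0ℓ 0ℓ →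
  (Φ : Functor) (I : Set) (G : I → Graph Φ) →
  let open Functor Φ
      open Graph
  in (Eprod : Set) (b : Eprod → ((i : I) → E (G i)))
     (gprod : Eprod → F ((i : I) → V (G i))) →
     (pb : IsPullback (λ (x : (i : I) → E (G i)) (i : I) → g (G i) (x i))
                      (λ (y : F ((i : I) → V (G i))) (i : I) → fmap (λ (v : (j : I) → V (G j)) → v i) y)
                      b gprod) →
     IsProduct Φ G (mkGraph Eprod ((i : I) → V (G i)) gprod)
       (λ i → mkHom (λ e → b e i) (λ v → v i) (λ e → cong-app (proj₁ pb e) i))
theorem4p6 ext Φ I G Eprod b gprod pb = ProductFromPullback.isProduct ext Φ G b gprod pb
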